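{- Let $G$ be a finite group, $S\subseteq G$ a generating set, $g\in G$ and $s\in S$. If there exists a path in the Cayley graph $\Gamma=\Gamma(G,S)$ from the identity $e$ to $gs$ whose vertex set intersects every right coset $\langle g\rangle x$ ($x\in G$) of the cyclic subgroup $\langle g\rangle$ in exactly one element, then $\kappa(\Gamma)\ge \operatorname{ord}(g)$.
   Context: The Cayley graph $\Gamma(G,S)$ has vertex set $G$ and an undirected edge $\{x,xs\}$ for every $x\in G$ and $s\in S$. For a finite graph $H$ with $N$ vertices, a Hamilton cycle $C=(x_1,\ldots,x_N)$ is $k$-symmetric (for a positive integer $k$ dividing $N$) if the map $x_i\mapsto x_{i+N/k}$ (indices modulo $N$) is an automorphism of $H$; $\kappa(H,C)$ is the largest such $k$, and $\kappa(H)$ is the maximum of $\kappa(H,C)$ over all Hamilton cycles $C$ of $H$ ($0$ if none exists). -}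

module Defs where

open import Data.Nat as ℕ using (ℕ; zero; suc; _≤_; _<_; _%_)
open import Data.Nat.DivMod using (m%n<n)
open import Data.Fin as Fin using (Fin; toℕ; fromℕ<; inject₁)
open import Data.Fin.Subset using (Subset; _∈_)
open import Data.Product using (Σ; ∃; ∃-syntax; _×_; _,_)
open import Data.Sum using (_⊎_)
open import Function.Definitions using (Injective; Surjective)
open import Relation.Binary.PropositionalEquality using (_≡_)
open import Algebra.Structures using (IsGroup)

-- A finite group of order n, presented with carrier Fin n
-- (every finite group is isomorphic to one of this form).
record FinGroup (n : ℕ) : Set where
  field
    _∙_     : Fin n → Fin n → Fin n
    ε       : Fin n
    _⁻¹     : Fin n → Fin n
    isGroup : IsGroup _≡_ _∙_ ε _⁻¹

  infixl 7 _∙_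

  _^_ : Fin n → ℕ → Fin n
  g ^ zero  = ε
  g ^ suc m = g ∙ (g ^ m)

  IsOrder : Fin n → ℕ → Set
  IsOrder g m = 0 < m × g ^ m ≡ ε × (∀ j → 0 < j → g ^ j ≡ ε → m ≤ j)

  -- y lies in the right coset ⟨g⟩x   (⟨g⟩ = {g^i}, G finite)
  InCoset : Fin n → Fin n → Fin n → Set
  InCoset g x y = ∃[ i ] y ≡ (g ^ i) ∙ x

  data Generated (S : Subset n) : Fin n → Set where
    gen-ε   : Generated S ε
    gen-mul : ∀ {x s} → Generated S x → s ∈ S → Generated S (x ∙ s)
    gen-inv : ∀ {x s} → Generated S x → s ∈ S → Generated S (x ∙ (s ⁻¹))

  Generates : Subset n → Set
  Generates S = ∀ x → Generated S x

  Adj : Subset n → Fin n → Fin n → Set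
  Adj S x y = ∃[ s ] (s ∈ S × (y ≡ x ∙ s ⊎ x ≡ y ∙ s))

Graph : ℕ → Set₁
Graph n = Fin n → Fin n → Set

rot : ∀ {n} → ℕ → Fin n → Fin n
rot {suc n} d i = fromℕ< (m%n<n (toℕ i ℕ.+ d) (suc n))

IsAutomorphism : ∀ {n} → Graph n → (Fin n → Fin n) → Set
IsAutomorphism {n} H σ =
  Injective _≡_ _≡_ σ × Surjective _≡_ _≡_ σ ×
  (∀ x y → (H x y → H (σ x) (σ y)) × (H (σ x) (σ y) → H x y))

record HamiltonCycle {n} (H : Graph n) : Set where
  field
    c    : Fin n → Fin n
    inj  : Injective _≡_ _≡_ c
    surj : Surjective _≡_ _≡_ c
    adj  : ∀ i → H (c i) (c (rot 1 i))

-- C is k-symmetric: k positive, k ∣ N (N = d·k), and x_i ↦ x_{i+N/k}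
-- is an automorphism of H
KSymmetric : ∀ {n} (H : Graph n) → HamiltonCycle H → ℕ → Set
KSymmetric {n} H C k =
  0 < k × Σ ℕ λ d → n ≡ d ℕ.* k ×
    Σ (Fin n → Fin n) λ σ →
      (∀ i → σ (HamiltonCycle.c C i) ≡ HamiltonCycle.c C (rot d i)) ×
      IsAutomorphism H σ

-- κ(H) ≥ m, where κ(H) = max over Hamilton cycles C of κ(H,C)
-- (0 if H has no Hamilton cycle)
KappaAtLeast : ∀ {n} → Graph n → ℕ → Set
KappaAtLeast H m =
  m ≡ 0 ⊎ Σ (HamiltonCycle H) λ C → ∃[ k ] (m ≤ k × KSymmetric H C k)

record Path {n} (H : Graph n) (L : ℕ) : Set where
  field
    p   : Fin (suc L) → Fin n
    inj : Injective _≡_ _≡_ p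
    adj : ∀ (i : Fin L) → H (p (inject₁ i)) (p (Fin.suc i))

-- Let P = (p₀ = e, …, p_L = g s) be the path and m = ord(g). Concatenating the translates
-- P, g P, g² P, …, g^(m-1) P gives a closed walk: the translate g^q P ends at g^(q+1) s,
-- which is joined by the edge labelled s to g^(q+1) = g^(q+1) p₀, the start of the next
-- translate, and g^m P = P. Since P meets every coset ⟨g⟩x exactly once, the m(L+1)
-- vertices of the walk are pairwise distinct and exhaust G, so the walk is a Hamilton
-- cycle. Left multiplication by g is an automorphism of the Cayley graph which shifts
-- the cycle by L + 1 = |G| / m positions, so the cycle is m-symmetric.
module Submission where

open import Defs
open import Data.Nat using (ℕ; zero; suc; _≤_)
open import Data.Fin using (Fin; fromℕ)
open import Data.Fin.Subset using (Subset; _∈_)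
open import Data.Product using (Σ; ∃-syntax; _×_)
open import Relation.Binary.PropositionalEquality using (_≡_)

open import Data.Nat using (_+_; _*_; _∸_; _<_; _%_; _/_; pred; NonZero; >-nonZero; s≤s)
open import Data.Nat.Properties
  using (≤-refl; ≤-trans; ≤-antisym; <-irrefl; <-cmp; <⇒≤; m∸n≤m; m∸n+n≡m; m<n⇒0<n∸m;
         +-comm; +-assoc; *-suc; *-comm; m*n≢0; suc-pred; +-commutativeSemigroup)
open import Data.Nat.DivMod
  using (_mod_; m≡m%n+[m/n]*n; [m+kn]%n≡m%n; m<n⇒m%n≡m; +-distrib-/-∣ʳ;
         m<n⇒m/n≡0; m*n/n≡m; m<n*o⇒m/o<n)
open import Data.Nat.Divisibility using (n∣m*n)
open import Data.Fin using (toℕ; inject₁)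
open import Data.Fin.Properties
  using (toℕ-injective; toℕ<n; toℕ-fromℕ<; toℕ-fromℕ; toℕ-inject₁; injective⇒≤; ¬Fin0)
open import Data.Fin.Relation.Unary.Top using (view; ‵fromℕ; ‵inj₁)
open import Data.Product using (_,_; proj₁; proj₂)
open import Data.Sum using (inj₁; inj₂)
open import Data.Empty using (⊥-elim)
open import Relation.Nullary using (¬_; contradiction)
open import Relation.Binary.Definitions using (tri<; tri≈; tri>)
open import Relation.Binary.PropositionalEquality
  using (refl; sym; trans; cong; cong₂; subst; subst₂; module ≡-Reasoning)
open import Algebra.Bundles using (Group)
open import Algebra.Structures using (IsGroup)
import Algebra.Properties.Group as GroupProperties
open import Algebra.Properties.CommutativeSemigroup +-commutativeSemigroup using (x∙yz≈y∙xz)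

open ≡-Reasoning

module _ {a} {A : Set a} (w : ℕ → A) {P : ℕ} (periodic : ∀ t → w (P + t) ≡ w t) where

  periodic-* : ∀ k t → w (k * P + t) ≡ w t
  periodic-* zero    t = refl
  periodic-* (suc k) t = begin
    w (P + k * P + t)   ≡⟨ cong w (+-assoc P (k * P) t) ⟩
    w (P + (k * P + t)) ≡⟨ periodic (k * P + t) ⟩
    w (k * P + t)       ≡⟨ periodic-* k t ⟩
    w t                 ∎

  periodic-% : .{{_ : NonZero P}} → ∀ t → w (t % P) ≡ w t
  periodic-% t = begin
    w (t % P)               ≡⟨ sym (periodic-* (t / P) (t % P)) ⟩
    w (t / P * P + t % P)   ≡⟨ cong w (+-comm (t / P * P) (t % P)) ⟩
    w (t % P + t / P * P)   ≡⟨ cong w (sym (m≡m%n+[m/n]*n t P)) ⟩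
    w t                     ∎

size≡period : ∀ {n P} .{{_ : NonZero P}} (w : ℕ → Fin n) →
              (∀ t → w (P + t) ≡ w t) →
              (∀ {t t'} → t < P → t' < P → w t ≡ w t' → t ≡ t') →
              (∀ y → ∃[ t ] w t ≡ y) →
              n ≡ P
size≡period {n} {P} w periodic injective covers =
  ≤-antisym (injective⇒≤ index-injective) (injective⇒≤ walk-injective)
  where
  walk-injective : ∀ {u v : Fin P} → w (toℕ u) ≡ w (toℕ v) → u ≡ v
  walk-injective {u} {v} e = toℕ-injective (injective (toℕ<n u) (toℕ<n v) e)

  index : Fin n → Fin P
  index y = proj₁ (covers y) mod P

  walk-index : ∀ y → w (toℕ (index y)) ≡ y
  walk-index y = begin
    w (toℕ (index y)) ≡⟨ cong w (toℕ-fromℕ< _) ⟩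
    w (t % P)         ≡⟨ periodic-% w periodic t ⟩
    w t               ≡⟨ proj₂ (covers y) ⟩
    y                 ∎
    where t = proj₁ (covers y)

  index-injective : ∀ {y y'} → index y ≡ index y' → y ≡ y'
  index-injective {y} {y'} e =
    trans (sym (walk-index y)) (trans (cong (λ u → w (toℕ u)) e) (walk-index y'))

module HamiltonCycleOfWalk {n} (H : Graph (suc n)) (w : ℕ → Fin (suc n))
  (periodic : ∀ t → w (suc n + t) ≡ w t)
  (adjacent : ∀ t → H (w t) (w (suc t)))
  (injective : ∀ {t t'} → t < suc n → t' < suc n → w t ≡ w t' → t ≡ t')
  (covers : ∀ y → ∃[ t ] w t ≡ y) where

  walk-rot : ∀ d i → w (toℕ (rot d i)) ≡ w (toℕ i + d)
  walk-rot d i = trans (cong w (toℕ-fromℕ< _)) (periodic-% w periodic (toℕ i + d))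

  hamiltonCycle : HamiltonCycle H
  hamiltonCycle = record
    { c    = λ i → w (toℕ i)
    ; inj  = λ {i} {j} e → toℕ-injective (injective (toℕ<n i) (toℕ<n j) e)
    ; surj = λ y → proj₁ (covers y) mod suc n , λ { refl →
               trans (walk-rot (proj₁ (covers y)) Data.Fin.zero) (proj₂ (covers y)) }
    ; adj  = λ i → subst (H (w (toℕ i))) (sym (trans (walk-rot 1 i) (cong w (+-comm (toℕ i) 1))))
                     (adjacent (toℕ i))
    }

  hamiltonCycle-symmetric : ∀ {σ d k} → IsAutomorphism H σ → (∀ t → σ (w t) ≡ w (d + t)) →
                            suc n ≡ d * k → 0 < k → KSymmetric H hamiltonCycle k
  hamiltonCycle-symmetric {σ} {d} σ-aut shift n≡d*k 0<k =
    0<k , d , n≡d*k , σ ,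
    (λ i → trans (shift (toℕ i)) (trans (cong w (+-comm d (toℕ i))) (sym (walk-rot d i)))) ,
    σ-aut

module _ {n} (G : FinGroup n) where
  open FinGroup G
  open IsGroup isGroup using (assoc; identityˡ; identityʳ; inverseˡ; inverseʳ)

  group : Group _ _
  group = record { isGroup = isGroup }

  open GroupProperties group using (∙-cancelˡ; ∙-cancelʳ)

  ^-+ : ∀ g a b → g ^ (a + b) ≡ g ^ a ∙ g ^ b
  ^-+ g zero    b = sym (identityˡ (g ^ b))
  ^-+ g (suc a) b = trans (cong (g ∙_) (^-+ g a b)) (sym (assoc g (g ^ a) (g ^ b)))

  ^-sucʳ : ∀ g a → g ^ suc a ≡ g ^ a ∙ g
  ^-sucʳ g zero    = trans (identityʳ g) (sym (identityˡ g))
  ^-sucʳ g (suc a) = trans (cong (g ∙_) (^-sucʳ g a)) (sym (assoc g (g ^ a) g))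

  InCoset-refl : ∀ g x → InCoset g x x
  InCoset-refl g x = 0 , sym (identityˡ x)

  InCoset-trans : ∀ {g x y z} → InCoset g x y → InCoset g y z → InCoset g x z
  InCoset-trans {g} {x} (i , refl) (j , refl) = j + i , (begin
    g ^ j ∙ (g ^ i ∙ x) ≡⟨ sym (assoc (g ^ j) (g ^ i) x) ⟩
    g ^ j ∙ g ^ i ∙ x   ≡⟨ cong (_∙ x) (sym (^-+ g j i)) ⟩
    g ^ (j + i) ∙ x     ∎)

  module Order {g m} (ord : IsOrder g m) where
    instance
      order-nonZero : NonZero m
      order-nonZero = >-nonZero (proj₁ ord)

    ^-* : ∀ k → g ^ (k * m) ≡ ε
    ^-* zero    = refl
    ^-* (suc k) = begin
      g ^ (m + k * m)     ≡⟨ ^-+ g m (k * m) ⟩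
      g ^ m ∙ g ^ (k * m) ≡⟨ cong₂ _∙_ (proj₁ (proj₂ ord)) (^-* k) ⟩
      ε ∙ ε               ≡⟨ identityˡ ε ⟩
      ε                   ∎

    ^-inverse : ∀ a → g ^ (a * pred m) ∙ g ^ a ≡ ε
    ^-inverse a = begin
      g ^ (a * pred m) ∙ g ^ a ≡⟨ sym (^-+ g (a * pred m) a) ⟩
      g ^ (a * pred m + a)     ≡⟨ cong (g ^_) (+-comm (a * pred m) a) ⟩
      g ^ (a + a * pred m)     ≡⟨ cong (g ^_) (sym (*-suc a (pred m))) ⟩
      g ^ (a * suc (pred m))   ≡⟨ cong (λ k → g ^ (a * k)) (suc-pred m) ⟩
      g ^ (a * m)              ≡⟨ ^-* a ⟩
      ε                        ∎

    InCoset-sym : ∀ {x y} → InCoset g x y → InCoset g y x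
    InCoset-sym {x} (i , refl) = i * pred m , (begin
      x                              ≡⟨ sym (identityˡ x) ⟩
      ε ∙ x                          ≡⟨ cong (_∙ x) (sym (^-inverse i)) ⟩
      g ^ (i * pred m) ∙ g ^ i ∙ x   ≡⟨ assoc (g ^ (i * pred m)) (g ^ i) x ⟩
      g ^ (i * pred m) ∙ (g ^ i ∙ x) ∎)

    ^-≢-below-order : ∀ {a b} → a < b → b < m → ¬ (g ^ a ≡ g ^ b)
    ^-≢-below-order {a} {b} a<b b<m e =
      <-irrefl refl (≤-trans (s≤s m≤b∸a) (≤-trans (s≤s (m∸n≤m b a)) b<m))
      where
      g^[b∸a]≡ε : g ^ (b ∸ a) ≡ ε
      g^[b∸a]≡ε = ∙-cancelʳ (g ^ a) (g ^ (b ∸ a)) ε (begin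
        g ^ (b ∸ a) ∙ g ^ a ≡⟨ sym (^-+ g (b ∸ a) a) ⟩
        g ^ (b ∸ a + a)     ≡⟨ cong (g ^_) (m∸n+n≡m (<⇒≤ a<b)) ⟩
        g ^ b               ≡⟨ sym e ⟩
        g ^ a               ≡⟨ sym (identityˡ (g ^ a)) ⟩
        ε ∙ g ^ a           ∎)

      m≤b∸a : m ≤ b ∸ a
      m≤b∸a = proj₂ (proj₂ ord) (b ∸ a) (m<n⇒0<n∸m a<b) g^[b∸a]≡ε

    ^-injective-below-order : ∀ {a b} → a < m → b < m → g ^ a ≡ g ^ b → a ≡ b
    ^-injective-below-order {a} {b} a<m b<m e with <-cmp a b
    ... | tri< a<b _ _ = contradiction e (^-≢-below-order a<b b<m)
    ... | tri≈ _ a≡b _ = a≡b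
    ... | tri> _ _ b<a = contradiction (sym e) (^-≢-below-order b<a a<m)

  module _ (S : Subset n) where

    Adj-∙ˡ : ∀ h {x y} → Adj S x y → Adj S (h ∙ x) (h ∙ y)
    Adj-∙ˡ h (t , t∈S , inj₁ y≡xt) = t , t∈S , inj₁ (trans (cong (h ∙_) y≡xt) (sym (assoc _ _ _)))
    Adj-∙ˡ h (t , t∈S , inj₂ x≡yt) = t , t∈S , inj₂ (trans (cong (h ∙_) x≡yt) (sym (assoc _ _ _)))

    ∙ˡ-isAutomorphism : ∀ h → IsAutomorphism (Adj S) (h ∙_)
    ∙ˡ-isAutomorphism h =
      (λ {x} {y} → ∙-cancelˡ h x y) ,
      (λ y → h ⁻¹ ∙ y , λ { refl → unfold-inverse y }) ,
      λ x y → Adj-∙ˡ h , λ hx~hy → subst₂ (Adj S) (fold-inverse x) (fold-inverse y) (Adj-∙ˡ (h ⁻¹) hx~hy)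
      where
      unfold-inverse : ∀ y → h ∙ (h ⁻¹ ∙ y) ≡ y
      unfold-inverse y = trans (sym (assoc _ _ _)) (trans (cong (_∙ y) (inverseʳ h)) (identityˡ y))
      fold-inverse : ∀ x → h ⁻¹ ∙ (h ∙ x) ≡ x
      fold-inverse x = trans (sym (assoc _ _ _)) (trans (cong (_∙ x) (inverseˡ h)) (identityˡ x))

    MeetsEveryCosetOnce : Fin n → ∀ {L} → (Fin (suc L) → Fin n) → Set
    MeetsEveryCosetOnce g p =
      ∀ x → (∃[ j ] InCoset g x (p j)) ×
            (∀ j j' → InCoset g x (p j) → InCoset g x (p j') → p j ≡ p j')

    module TransversalWalk {g s} (s∈S : s ∈ S) {L} (P : Path (Adj S) L)
      (starts : Path.p P Data.Fin.zero ≡ ε) (ends : Path.p P (fromℕ L) ≡ g ∙ s)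
      (transversal : MeetsEveryCosetOnce g (Path.p P)) {m} (ord : IsOrder g m) where

      open Order ord

      N : ℕ
      N = suc L

      p : Fin N → Fin n
      p = Path.p P

      walk : ℕ → Fin n
      walk t = g ^ (t / N) ∙ p (t mod N)

      walk-eval : ∀ q (r : Fin N) → walk (toℕ r + q * N) ≡ g ^ q ∙ p r
      walk-eval q r = cong₂ (λ a b → g ^ a ∙ p b) quotient remainder
        where
        quotient : (toℕ r + q * N) / N ≡ q
        quotient = begin
          (toℕ r + q * N) / N       ≡⟨ +-distrib-/-∣ʳ (toℕ r) (n∣m*n q) ⟩
          toℕ r / N + q * N / N     ≡⟨ cong₂ _+_ (m<n⇒m/n≡0 (toℕ<n r)) (m*n/n≡m q N) ⟩
          q                         ∎
        remainder : (toℕ r + q * N) mod N ≡ r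
        remainder = toℕ-injective (trans (toℕ-fromℕ< _)
                      (trans ([m+kn]%n≡m%n (toℕ r) q N) (m<n⇒m%n≡m (toℕ<n r))))

      block-decomposition : ∀ t → t ≡ toℕ (t mod N) + t / N * N
      block-decomposition t = trans (m≡m%n+[m/n]*n t N) (cong (_+ t / N * N) (sym (toℕ-fromℕ< _)))

      byBlockPosition : (Q : ℕ → Set) → (∀ q (r : Fin N) → Q (toℕ r + q * N)) → ∀ t → Q t
      byBlockPosition Q h t = subst Q (sym (block-decomposition t)) (h (t / N) (t mod N))

      walk-shift : ∀ t → g ∙ walk t ≡ walk (N + t)
      walk-shift = byBlockPosition (λ t → g ∙ walk t ≡ walk (N + t)) λ q r → begin
        g ∙ walk (toℕ r + q * N)   ≡⟨ cong (g ∙_) (walk-eval q r) ⟩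
        g ∙ (g ^ q ∙ p r)          ≡⟨ sym (assoc g (g ^ q) (p r)) ⟩
        g ^ suc q ∙ p r            ≡⟨ sym (walk-eval (suc q) r) ⟩
        walk (toℕ r + suc q * N)   ≡⟨ cong walk (sym (x∙yz≈y∙xz N (toℕ r) (q * N))) ⟩
        walk (N + (toℕ r + q * N)) ∎

      walk-shift* : ∀ k t → walk (k * N + t) ≡ g ^ k ∙ walk t
      walk-shift* zero    t = sym (identityˡ (walk t))
      walk-shift* (suc k) t = begin
        walk (N + k * N + t)   ≡⟨ cong walk (+-assoc N (k * N) t) ⟩
        walk (N + (k * N + t)) ≡⟨ sym (walk-shift (k * N + t)) ⟩
        g ∙ walk (k * N + t)   ≡⟨ cong (g ∙_) (walk-shift* k t) ⟩
        g ∙ (g ^ k ∙ walk t)   ≡⟨ sym (assoc g (g ^ k) (walk t)) ⟩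
        g ^ suc k ∙ walk t     ∎

      walk-periodic-m*N : ∀ t → walk (m * N + t) ≡ walk t
      walk-periodic-m*N t =
        trans (walk-shift* m t) (trans (cong (_∙ walk t) (proj₁ (proj₂ ord))) (identityˡ (walk t)))

      walk-adjacent : ∀ t → Adj S (walk t) (walk (suc t))
      walk-adjacent = byBlockPosition (λ t → Adj S (walk t) (walk (suc t))) adjacent-at
        where
        adjacent-at : ∀ q (r : Fin N) → Adj S (walk (toℕ r + q * N)) (walk (suc (toℕ r + q * N)))
        adjacent-at q r with view r
        ... | ‵inj₁ {i = i} _ =
          subst₂ (Adj S) (sym (walk-eval q (inject₁ i)))
                         (trans (sym (walk-eval q (Data.Fin.suc i)))
                                (cong (λ k → walk (suc k + q * N)) (sym (toℕ-inject₁ i))))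
                 (Adj-∙ˡ (g ^ q) (Path.adj P i))
        ... | ‵fromℕ = s , s∈S , inj₂ (begin
          walk (toℕ (fromℕ L) + q * N)        ≡⟨ walk-eval q (fromℕ L) ⟩
          g ^ q ∙ p (fromℕ L)                 ≡⟨ cong (g ^ q ∙_) ends ⟩
          g ^ q ∙ (g ∙ s)                     ≡⟨ sym (assoc (g ^ q) g s) ⟩
          g ^ q ∙ g ∙ s                       ≡⟨ cong (_∙ s) (sym (^-sucʳ g q)) ⟩
          g ^ suc q ∙ s                       ≡⟨ cong (_∙ s) (sym (identityʳ (g ^ suc q))) ⟩
          g ^ suc q ∙ ε ∙ s                   ≡⟨ cong (λ x → g ^ suc q ∙ x ∙ s) (sym starts) ⟩
          g ^ suc q ∙ p Data.Fin.zero ∙ s     ≡⟨ cong (_∙ s) (sym (walk-eval (suc q) Data.Fin.zero)) ⟩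
          walk (suc q * N) ∙ s                ≡⟨ cong (λ k → walk (suc k + q * N) ∙ s) (sym (toℕ-fromℕ L)) ⟩
          walk (suc (toℕ (fromℕ L) + q * N)) ∙ s ∎)

      translates-injective : ∀ {q q' r r'} → q < m → q' < m →
                             g ^ q ∙ p r ≡ g ^ q' ∙ p r' → q ≡ q' × r ≡ r'
      translates-injective {q} {q'} {r} {r'} q<m q'<m e =
        ^-injective-below-order q<m q'<m (∙-cancelʳ (p r) (g ^ q) (g ^ q') (trans e (cong (g ^ q' ∙_) (sym p≡)))) ,
        r≡r'
        where
        p-coset : InCoset g (p r) (p r')
        p-coset = InCoset-trans (q , refl) (subst (λ x → InCoset g x (p r')) (sym e) (InCoset-sym (q' , refl)))
        p≡ : p r ≡ p r'
        p≡ = proj₂ (transversal (p r)) r r' (InCoset-refl g (p r)) p-coset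
        r≡r' : r ≡ r'
        r≡r' = Path.inj P p≡

      walk-injective-below-m*N : ∀ {t t'} → t < m * N → t' < m * N → walk t ≡ walk t' → t ≡ t'
      walk-injective-below-m*N {t} {t'} t< t'< e = begin
        t                                  ≡⟨ block-decomposition t ⟩
        toℕ (t mod N) + t / N * N          ≡⟨ cong₂ (λ r q → toℕ r + q * N) r≡r' q≡q' ⟩
        toℕ (t' mod N) + t' / N * N        ≡⟨ sym (block-decomposition t') ⟩
        t'                                 ∎
        where
        blocks = translates-injective (m<n*o⇒m/o<n t<) (m<n*o⇒m/o<n t'<) e
        q≡q' = proj₁ blocks
        r≡r' = proj₂ blocks

      walk-covers : ∀ y → ∃[ t ] walk t ≡ y
      walk-covers y with proj₁ (transversal y)
      ... | j , pj∈⟨g⟩y with InCoset-sym pj∈⟨g⟩y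
      ...   | b , y≡ = toℕ j + b * N , trans (walk-eval b j) (sym y≡)

      n≡m*N : n ≡ m * N
      n≡m*N = size≡period {{m*n≢0 m N}} walk walk-periodic-m*N
                            walk-injective-below-m*N walk-covers

      walk-periodic : ∀ t → walk (n + t) ≡ walk t
      walk-periodic t = trans (cong (λ k → walk (k + t)) n≡m*N) (walk-periodic-m*N t)

      walk-injective : ∀ {t t'} → t < n → t' < n → walk t ≡ walk t' → t ≡ t'
      walk-injective t<n t'<n = walk-injective-below-m*N (subst (_ <_) n≡m*N t<n)
                                                     (subst (_ <_) n≡m*N t'<n)

lemma6p2 : ∀ {n} (G : FinGroup n) (S : Subset n) → FinGroup.Generates G S →
    ∀ (g s : Fin n) → s ∈ S →
    (∃[ L ] Σ (Path (FinGroup.Adj G S) L) λ P →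
      Path.p P Data.Fin.zero ≡ FinGroup.ε G ×
      Path.p P (fromℕ L) ≡ FinGroup._∙_ G g s ×
      (∀ x → (∃[ j ] FinGroup.InCoset G g x (Path.p P j)) ×
             (∀ j j' → FinGroup.InCoset G g x (Path.p P j) →
                       FinGroup.InCoset G g x (Path.p P j') →
                       Path.p P j ≡ Path.p P j'))) →
    ∀ m → FinGroup.IsOrder G g m →
    KappaAtLeast (FinGroup.Adj G S) m
lemma6p2 {zero}  G _ _ _ _ _ _ _ _ = ⊥-elim (¬Fin0 (FinGroup.ε G))
lemma6p2 {suc _} G S _ g s s∈S (L , P , starts , ends , transversal) m ord =
  inj₂ (hamiltonCycle , m , ≤-refl ,
        hamiltonCycle-symmetric (∙ˡ-isAutomorphism G S g) walk-shift
          (trans n≡m*N (*-comm m N)) (proj₁ ord))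
  where
  open TransversalWalk G S s∈S P starts ends transversal ord
  open HamiltonCycleOfWalk (FinGroup.Adj G S) walk walk-periodic walk-adjacent walk-injective walk-covers
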